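{- Let $r<w$ be positive reals. Every deterministic online algorithm (with no restriction on memory) for the $(n,k,r,w)$-Parity for Number of Hats problem is (no better than) $(w/r)$-competitive: there is a feasible input on which the cost of its output is $w$.
   Context: An online algorithm must produce its answer $y_i$ to request $x_i$ from $x_1,\dots,x_i$ (and earlier answers) only; it is $c$-competitive if there is $\alpha\ge 0$ with $cost(A(I))\le c\cdot cost(Opt(I))+\alpha$ for all inputs $I$, $Opt$ an optimal offline algorithm. For $X\in\{0,1\}^m$ with $\#_1(X)=v\cdot 2^k$, $v$ an integer, $PartialMOD_m^k(X)=v\bmod 2$. The $(n,k,r,w)$-Parity for Number of Hats problem: feasible inputs are $I=(2,X_1,2,X_2,2,X_3)$ of length $n=m_1+m_2+m_3+3$, with $m_i\ge 2^{k+1}$, $X_i\in\{0,1\}^{m_i}$, $\#_1(X_i)$ a multiple of $2^k$. Let $y_1,y_2,y_3$ be the output bits at the three requests with value $2$ and $z_j=\bigoplus_{i=j}^{3}PartialMOD_{m_i}^k(X_i)$. The cost is $r$ if $y_j=z_j$ for all $j$, and $w$ otherwise, with $r<w$.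
   Formalization: The cost values r < w are positive rationals rather than positive reals. -}

module Defs where

open import Data.Bool using (Bool; true; false; _xor_; if_then_else_; _∧_)
open import Data.Bool.Properties using () renaming (_≟_ to _≟ᵇ_)
open import Data.Nat using (ℕ; zero; suc; _+_; _*_; _^_; _≤_; _≡ᵇ_)
open import Data.Nat.DivMod using (_/_; _%_)
open import Data.Nat.Properties using (m^n≢0)
open import Data.Nat.Divisibility using (_∣_)
open import Data.List using (List; []; _∷_; _++_; length; filter; [_])
open import Data.Rational using (ℚ)
open import Relation.Binary.PropositionalEquality using (_≡_)
open import Relation.Nullary.Decidable using (⌊_⌋)

data Req : Set where
  bit : Bool → Req
  two : Req

#₁ : List Bool → ℕ
#₁ [] = 0
#₁ (true ∷ xs) = suc (#₁ xs)
#₁ (false ∷ xs) = #₁ xs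

-- PartialMOD^k(X) = v mod 2 where #₁(X) = v · 2^k (only meaningful when 2^k ∣ #₁ X);
-- encoded as a Bool (true = 1).
PartialMOD : (k : ℕ) → List Bool → Bool
PartialMOD k X = (((#₁ X) / (2 ^ k)) % 2) ≡ᵇ 1
  where instance _ = m^n≢0 2 k

bits : List Bool → List Req
bits [] = []
bits (b ∷ bs) = bit b ∷ bits bs

-- A deterministic online algorithm (unbounded memory): its answer y_i to request x_i
-- is a function of the prefix x_1 … x_i (earlier answers are themselves determined
-- by shorter prefixes, so need not be passed separately).
OnlineAlg : Set
OnlineAlg = List Req → Bool

record FeasibleInput (n k : ℕ) : Set where
  field
    X₁ X₂ X₃ : List Bool
    len₁ : 2 ^ (suc k) ≤ length X₁
    len₂ : 2 ^ (suc k) ≤ length X₂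
    len₃ : 2 ^ (suc k) ≤ length X₃
    div₁ : 2 ^ k ∣ #₁ X₁
    div₂ : 2 ^ k ∣ #₁ X₂
    div₃ : 2 ^ k ∣ #₁ X₃
    totalLen : length X₁ + length X₂ + length X₃ + 3 ≡ n

  input : List Req
  input = two ∷ bits X₁ ++ two ∷ bits X₂ ++ two ∷ bits X₃

  prefix₁ prefix₂ prefix₃ : List Req
  prefix₁ = [ two ]
  prefix₂ = two ∷ bits X₁ ++ [ two ]
  prefix₃ = two ∷ bits X₁ ++ two ∷ bits X₂ ++ [ two ]

  z₁ z₂ z₃ : ℕ → Bool
  z₃ k' = PartialMOD k' X₃
  z₂ k' = PartialMOD k' X₂ xor z₃ k'
  z₁ k' = PartialMOD k' X₁ xor z₂ k'

open FeasibleInput public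

cost : ∀ {n k} → (r w : ℚ) → OnlineAlg → FeasibleInput n k → ℚ
cost {k = k} r w A I =
  if ⌊ A (prefix₁ I) ≟ᵇ z₁ I k ⌋ ∧ ⌊ A (prefix₂ I) ≟ᵇ z₂ I k ⌋ ∧ ⌊ A (prefix₃ I) ≟ᵇ z₃ I k ⌋
  then r else w

module Submission where

-- The lower bound is an adversary argument.  The first request of every
-- feasible input is the single value 2, so the algorithm's first answer
-- y₁ = A [ 2 ] is fixed before any hat is seen.  The adversary then chooses
-- the hats so that z₁ = PartialMOD(X₁) ⊕ PartialMOD(X₂) ⊕ PartialMOD(X₃) is the
-- opposite bit: X₁ and X₂ are all zeros of the minimal length 2^(k+1), and X₃
-- is a "parity block" of the remaining length containing 2^k ones exactly when
-- z₁ should be 1.  Then y₁ ≠ z₁ and the cost is w.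

open import Defs
open import Data.Nat using (ℕ; suc; _+_; _*_; _^_; _≤_; _%_; _≡ᵇ_)
open import Data.Rational using (ℚ; 0ℚ; _<_)
open import Data.Product using (Σ; _,_)
open import Relation.Binary.PropositionalEquality using (_≡_)

open import Data.Bool using (Bool; true; false; not; if_then_else_)
open import Data.Bool.Properties using (not-¬) renaming (_≟_ to _≟ᵇ_)
open import Data.List using (List; []; _∷_; _++_; length; replicate; [_])
open import Data.List.Properties using (length-++; length-replicate)
open import Data.Nat.DivMod using (m*n/n≡m)
open import Data.Nat.Divisibility using (divides)
open import Data.Nat.Properties using (m≤n⇒∃[o]m+o≡n; m≤m+n; ≤-refl; +-identityʳ; *-identityˡ; m^n≢0)
open import Data.Nat.Tactic.RingSolver using (solve-∀)
open import Relation.Binary.PropositionalEquality using (refl; sym; trans; cong; cong₂; subst; _≢_; module ≡-Reasoning)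
open import Relation.Nullary using (yes; no; contradiction)

#₁-++ : ∀ xs ys → #₁ (xs ++ ys) ≡ #₁ xs + #₁ ys
#₁-++ [] ys = refl
#₁-++ (true ∷ xs) ys = cong suc (#₁-++ xs ys)
#₁-++ (false ∷ xs) ys = #₁-++ xs ys

#₁-replicate : ∀ m b → #₁ (replicate m b) ≡ (if b then m else 0)
#₁-replicate 0 true = refl
#₁-replicate 0 false = refl
#₁-replicate (suc m) true = cong suc (#₁-replicate m true)
#₁-replicate (suc m) false = #₁-replicate m false

PartialMOD-count : ∀ k v X → #₁ X ≡ v * 2 ^ k → PartialMOD k X ≡ (v % 2 ≡ᵇ 1)
PartialMOD-count k v X count rewrite count | m*n/n≡m v (2 ^ k) {{m^n≢0 2 k}} = refl

PartialMOD-zeros : ∀ k m → PartialMOD k (replicate m false) ≡ false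
PartialMOD-zeros k m = PartialMOD-count k 0 (replicate m false) (#₁-replicate m false)

groups : Bool → ℕ
groups b = if b then 1 else 0

groups-parity : ∀ b → (groups b % 2 ≡ᵇ 1) ≡ b
groups-parity true = refl
groups-parity false = refl

parityBlock : ℕ → ℕ → Bool → List Bool
parityBlock k d b = replicate (2 ^ k) b ++ replicate (2 ^ k + d) false

#₁-parityBlock : ∀ k d b → #₁ (parityBlock k d b) ≡ groups b * 2 ^ k
#₁-parityBlock k d b = begin
  #₁ (parityBlock k d b)
    ≡⟨ #₁-++ (replicate (2 ^ k) b) (replicate (2 ^ k + d) false) ⟩
  #₁ (replicate (2 ^ k) b) + #₁ (replicate (2 ^ k + d) false)
    ≡⟨ cong₂ _+_ (#₁-replicate (2 ^ k) b) (#₁-replicate (2 ^ k + d) false) ⟩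
  (if b then 2 ^ k else 0) + 0
    ≡⟨ +-identityʳ _ ⟩
  (if b then 2 ^ k else 0)
    ≡⟨ ones b ⟩
  groups b * 2 ^ k ∎
  where
  open ≡-Reasoning
  ones : ∀ b → (if b then 2 ^ k else 0) ≡ groups b * 2 ^ k
  ones true = sym (*-identityˡ (2 ^ k))
  ones false = refl

length-parityBlock : ∀ k d b → length (parityBlock k d b) ≡ 2 ^ suc k + d
length-parityBlock k d b = begin
  length (parityBlock k d b)
    ≡⟨ length-++ (replicate (2 ^ k) b) ⟩
  length (replicate (2 ^ k) b) + length (replicate (2 ^ k + d) false)
    ≡⟨ cong₂ _+_ (length-replicate (2 ^ k)) (length-replicate (2 ^ k + d)) ⟩
  2 ^ k + (2 ^ k + d)
    ≡⟨ double (2 ^ k) d ⟩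
  2 ^ suc k + d ∎
  where
  open ≡-Reasoning
  double : ∀ m e → m + (m + e) ≡ 2 * m + e
  double = solve-∀

PartialMOD-parityBlock : ∀ k d b → PartialMOD k (parityBlock k d b) ≡ b
PartialMOD-parityBlock k d b =
  trans (PartialMOD-count k (groups b) (parityBlock k d b) (#₁-parityBlock k d b))
        (groups-parity b)

adversaryInput : ∀ {n} k d b → 3 * 2 ^ suc k + 3 + d ≡ n → FeasibleInput n k
adversaryInput k d b total = record
  { X₁ = zeros
  ; X₂ = zeros
  ; X₃ = parityBlock k d b
  ; len₁ = subst (L ≤_) (sym (length-replicate L)) ≤-refl
  ; len₂ = subst (L ≤_) (sym (length-replicate L)) ≤-refl
  ; len₃ = subst (L ≤_) (sym (length-parityBlock k d b)) (m≤m+n L d)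
  ; div₁ = divides 0 (#₁-replicate L false)
  ; div₂ = divides 0 (#₁-replicate L false)
  ; div₃ = divides (groups b) (#₁-parityBlock k d b)
  ; totalLen = begin
      length zeros + length zeros + length (parityBlock k d b) + 3
        ≡⟨ cong₂ (λ l l₃ → l + l + l₃ + 3) (length-replicate L) (length-parityBlock k d b) ⟩
      L + L + (L + d) + 3
        ≡⟨ regroup L d ⟩
      3 * L + 3 + d
        ≡⟨ total ⟩
      _ ∎
  }
  where
  open ≡-Reasoning
  L : ℕ
  L = 2 ^ suc k
  zeros : List Bool
  zeros = replicate L false
  regroup : ∀ m e → m + m + (m + e) + 3 ≡ 3 * m + 3 + e
  regroup = solve-∀

z₁-adversaryInput : ∀ {n} k d b (total : 3 * 2 ^ suc k + 3 + d ≡ n) →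
  z₁ (adversaryInput k d b total) k ≡ b
z₁-adversaryInput k d b total
  rewrite PartialMOD-zeros k (2 ^ suc k) | PartialMOD-parityBlock k d b = refl

cost-wrongFirst : ∀ {n k} (r w : ℚ) (A : OnlineAlg) (I : FeasibleInput n k) →
  A (prefix₁ I) ≢ z₁ I k → cost r w A I ≡ w
cost-wrongFirst {k = k} r w A I wrong with A (prefix₁ I) ≟ᵇ z₁ I k
... | yes right = contradiction right wrong
... | no _ = refl

theorem4 : (n k : ℕ) → (r w : ℚ) → 0ℚ < r → r < w →
    3 * 2 ^ (suc k) + 3 ≤ n →
    (A : OnlineAlg) → Σ (FeasibleInput n k) (λ I → cost r w A I ≡ w)
theorem4 n k r w _ _ longEnough A with m≤n⇒∃[o]m+o≡n longEnough
... | d , total = I , cost-wrongFirst r w A I firstAnswerWrong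
  where
  -- the adversary targets the opposite of the (input-independent) first answer
  I : FeasibleInput n k
  I = adversaryInput k d (not (A [ two ])) total
  firstAnswerWrong : A [ two ] ≢ z₁ I k
  firstAnswerWrong = subst (A [ two ] ≢_) (sym (z₁-adversaryInput k d (not (A [ two ])) total)) (not-¬ refl)
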